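{- Let $a,b$ be nonnegative integers and $x$ a positive integer, and let $L=\{1^a,2^b,x\}$ (a multiset of size $v-1=a+b+1$, in which $x$ appears with multiplicity one in addition to the $a$ copies of $1$ and $b$ copies of $2$). If $L$ is admissible, then $L$ is realizable in $K_v$.
   Context: Exponents denote multiplicities. $K_v$ is the complete graph on vertex set $\{0,1,\dots,v-1\}$, with edge length $\ell(p,q)=\min(|p-q|,v-|p-q|)$. A multiset $L$ is realizable in $K_v$ if some Hamiltonian path of $K_v$ has multiset of edge lengths exactly $L$. A multiset $L$ of size $v-1$ of positive integers is admissible if its largest element is at most $\lfloor v/2\rfloor$ and for every divisor $d$ of $v$ the number of elements of $L$ (with multiplicity) that are multiples of $d$ is at most $v-d$. -}

module Defs where

open import Data.Nat using (ℕ; zero; suc; _+_; _∸_; _≤_; _<_; _⊓_; _/_)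
open import Data.Nat.Divisibility using (_∣_; _∣?_)
open import Data.List using (List; []; _∷_; length; replicate; _++_; filter; [_])
open import Data.List.Relation.Unary.All using (All)
open import Data.List.Relation.Unary.Unique.Propositional using (Unique)
open import Data.List.Relation.Binary.Permutation.Propositional using (_↭_)
open import Data.Product using (Σ; _×_)
open import Relation.Binary.PropositionalEquality using (_≡_)

absDiff : ℕ → ℕ → ℕ
absDiff p q = (p ∸ q) + (q ∸ p)

edgeLen : ℕ → ℕ → ℕ → ℕ
edgeLen v p q = absDiff p q ⊓ (v ∸ absDiff p q)

pathLengths : ℕ → List ℕ → List ℕ
pathLengths v [] = []
pathLengths v (p ∷ []) = []
pathLengths v (p ∷ q ∷ ps) = edgeLen v p q ∷ pathLengths v (q ∷ ps)

IsHamPath : ℕ → List ℕ → Set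
IsHamPath v ps = (length ps ≡ v) × Unique ps × All (_< v) ps

-- multisets are lists up to permutation (_↭_)
Realizable : ℕ → List ℕ → Set
Realizable v L = Σ (List ℕ) (λ ps → IsHamPath v ps × (pathLengths v ps ↭ L))

countMultiples : ℕ → List ℕ → ℕ
countMultiples d L = length (filter (d ∣?_) L)

Admissible : ℕ → List ℕ → Set
Admissible v L =
  (suc (length L) ≡ v) ×
  All (λ y → 1 ≤ y × y ≤ v / 2) L ×
  ((d : ℕ) → d ∣ v → countMultiples d L ≤ v ∸ d)

L12x : ℕ → ℕ → ℕ → List ℕ
L12x a b x = replicate a 1 ++ replicate b 2 ++ [ x ]

-- Apart from the jump x, every edge has length 1 or 2, so the Hamiltonian paths are
-- assembled from arithmetic progressions of step 1 and 2, joined by single edges.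
--
-- With at least two 1's, [0, x) and [x, v) are each covered by a block (1's up,
-- 2's up, a turn by 1, 2's down back next to the 1's); the first block is walked
-- backwards so that it ends at 0, and the jump 0 → x enters the second one.  For
-- x = 1 a single block covers everything.
--
-- With at most one 1, the path is three runs of step 2 through the even and the
-- odd vertices.  Their two junctions are the jump x and either the 1 or the
-- wrap-around edge between 1 and v − 1, whose length is also 2; which runs to take
-- depends on the parities of x and v.  With a = 0 and v even only the jump can
-- change parity, so x must be odd: this is what admissibility for the divisor 2
-- guarantees.

module Submission where

open import Defs
open import Data.Nat using (ℕ; zero; suc; pred; _+_; _*_; _∸_; _/_; _≤_; _⊓_; z≤n; s≤s)
open import Data.Nat.Divisibility using (_∣_; _∣?_; divides; ∣-refl)
open import Data.Nat.DivMod using (m/n*n≤m)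
open import Data.Nat.Tactic.RingSolver using (solve-∀)
open import Data.Nat.Properties
open import Data.List using (List; []; _∷_; [_]; _++_; _∷ʳ_; length; replicate; reverse; drop; upTo; applyUpTo)
open import Data.List.Properties using (++-assoc; ++-identityʳ; filter-accept; length-++; length-replicate; length-upTo; unfold-reverse)
open import Data.List.Membership.Propositional using (_∈_)
open import Data.List.Membership.Propositional.Properties using (∈-upTo⁻; ∈-++⁺ʳ)
open import Data.List.Relation.Unary.Any using (here)
open import Data.List.Relation.Unary.All as All using (All)
open import Data.List.Relation.Unary.Unique.Propositional.Properties using (upTo⁺)
open import Data.List.Relation.Binary.Permutation.Propositional using (_↭_; ↭-refl; ↭-prep; ↭-sym; ↭-trans; ↭-reflexive; ↭⇒↭ₛ; module PermutationReasoning)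
open import Data.List.Relation.Binary.Permutation.Propositional.Properties using (All-resp-↭; ↭-length; ++⁺; ++⁺ˡ; ++⁺ʳ; ++-comm; shift; shifts; ∷↭∷ʳ; ↭-reverse)
import Data.List.Relation.Binary.Permutation.Setoid.Properties as Setoid↭
open import Data.Product using (_×_; _,_; proj₂; ∃-syntax)
open import Data.Empty using (⊥; ⊥-elim)
open import Data.Sum using (_⊎_; inj₁; inj₂)
open import Function using (_∘_)
open import Relation.Binary.PropositionalEquality using (_≡_; refl; sym; trans; cong; cong₂; subst; subst₂; setoid; module ≡-Reasoning)

-- Arithmetic progressions

ascending : ℕ → ℕ → ℕ → List ℕ
ascending s p zero    = []
ascending s p (suc n) = p ∷ ascending s (s + p) n

descending : ℕ → ℕ → ℕ → List ℕ
descending s q zero    = []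
descending s q (suc n) = n * s + q ∷ descending s q n

*-suc-+ : ∀ m s p → m * s + (s + p) ≡ suc m * s + p
*-suc-+ m s p = trans (sym (+-assoc (m * s) s p)) (cong (_+ p) (+-comm (m * s) s))

ascending-++ : ∀ s p m n → ascending s p (m + n) ≡ ascending s p m ++ ascending s (m * s + p) n
ascending-++ s p zero    n = refl
ascending-++ s p (suc m) n = cong (p ∷_) (trans (ascending-++ s (s + p) m n)
  (cong (λ q → ascending s (s + p) m ++ ascending s q n) (*-suc-+ m s p)))

ascending-join : ∀ {s p q k} m n → q ≡ m * s + p → m + n ≡ k →
                 ascending s p m ++ ascending s q n ≡ ascending s p k
ascending-join {s} {p} m n refl refl = sym (ascending-++ s p m n)

descending↭ascending : ∀ s q n → descending s q n ↭ ascending s q n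
descending↭ascending s q zero    = ↭-refl
descending↭ascending s q (suc n) = begin
  n * s + q ∷ descending s q n               ↭⟨ ↭-prep _ (descending↭ascending s q n) ⟩
  n * s + q ∷ ascending s q n                ↭⟨ ∷↭∷ʳ _ (ascending s q n) ⟩
  ascending s q n ++ ascending s (n * s + q) 1 ≡⟨ sym (ascending-++ s q n 1) ⟩
  ascending s q (n + 1)                      ≡⟨ cong (ascending s q) (+-comm n 1) ⟩
  ascending s q (suc n)                      ∎
  where open PermutationReasoning

interleave-even : ∀ r n → ascending 2 r n ++ ascending 2 (suc r) n ↭ ascending 1 r (n + n)
interleave-even r zero    = ↭-refl
interleave-even r (suc n) = ↭-prep r (begin
  ascending 2 (2 + r) n ++ suc r ∷ ascending 2 (3 + r) n   ↭⟨ shift (suc r) (ascending 2 (2 + r) n) _ ⟩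
  suc r ∷ ascending 2 (2 + r) n ++ ascending 2 (3 + r) n   ↭⟨ ↭-prep (suc r) (interleave-even (2 + r) n) ⟩
  ascending 1 (suc r) (suc (n + n))                          ≡⟨ cong (ascending 1 (suc r)) (sym (+-suc n n)) ⟩
  ascending 1 (suc r) (n + suc n)                            ∎)
  where open PermutationReasoning

interleave : ∀ {e} r n → e ≤ 1 → ascending 2 r (e + n) ++ ascending 2 (suc r) n ↭ ascending 1 r (e + (n + n))
interleave r n z≤n       = interleave-even r n
interleave r n (s≤s z≤n) = ↭-prep r (↭-trans (++-comm (ascending 2 (2 + r) n) (ascending 2 (suc r) n))
                                             (interleave-even (suc r) n))

ascending-applyUpTo : ∀ s p n f → (∀ k → f k ≡ k * s + p) → ascending s p n ≡ applyUpTo f n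
ascending-applyUpTo s p zero    f f≗ = refl
ascending-applyUpTo s p (suc n) f f≗ = cong₂ _∷_ (sym (f≗ 0))
  (ascending-applyUpTo s (s + p) n (f ∘ suc) λ k → trans (f≗ (suc k)) (sym (*-suc-+ k s p)))

ascending-upTo : ∀ n → ascending 1 0 n ≡ upTo n
ascending-upTo n = ascending-applyUpTo 1 0 n (λ k → k) λ k → sym (trans (+-identityʳ (k * 1)) (*-identityʳ k))

↭upTo⇒IsHamPath : ∀ {v ps} → ps ↭ upTo v → IsHamPath v ps
↭upTo⇒IsHamPath {v} ps↭ =
  trans (↭-length ps↭) (length-upTo v) ,
  Setoid↭.Unique-resp-↭ (setoid ℕ) (↭⇒↭ₛ (↭-sym ps↭)) (upTo⁺ v) ,
  All-resp-↭ (↭-sym ps↭) (All.tabulate ∈-upTo⁻)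

-- Edge lengths and path lengths

absDiff-comm : ∀ p q → absDiff p q ≡ absDiff q p
absDiff-comm p q = +-comm (p ∸ q) (q ∸ p)

absDiff-+ : ∀ d p → absDiff p (d + p) ≡ d
absDiff-+ d p = cong₂ _+_ (m≤n⇒m∸n≡0 (m≤n+m p d)) (m+n∸n≡m d p)

edgeLen-comm : ∀ v p q → edgeLen v p q ≡ edgeLen v q p
edgeLen-comm v p q = cong (λ d → d ⊓ (v ∸ d)) (absDiff-comm p q)

edgeLen-apart : ∀ {v d p q} → q ≡ d + p ⊎ p ≡ d + q → edgeLen v p q ≡ d ⊓ (v ∸ d)
edgeLen-apart {v} {d} {p} (inj₁ refl) = cong (λ a → a ⊓ (v ∸ a)) (absDiff-+ d p)
edgeLen-apart {v} {d} {q = q} (inj₂ refl) = trans (edgeLen-comm v (d + q) q) (edgeLen-apart (inj₁ refl))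

edgeLen-short : ∀ {v d} p q → d + d ≤ v → q ≡ d + p ⊎ p ≡ d + q → edgeLen v p q ≡ d
edgeLen-short {d = d} p q 2d≤v apart = trans (edgeLen-apart apart) (m≤n⇒m⊓n≡m (m+n≤o⇒m≤o∸n d 2d≤v))

edgeLen-wrap : ∀ {v e} p q d → d + e ≡ v → e ≤ d → q ≡ d + p ⊎ p ≡ d + q → edgeLen v p q ≡ e
edgeLen-wrap {e = e} p q d refl e≤d apart =
  trans (edgeLen-apart apart) (trans (cong (d ⊓_) (m+n∸m≡n d e)) (m≥n⇒m⊓n≡n e≤d))

edgeLen-turn : ∀ {v e} h t {q} → e ≤ 1 → 1 + 1 ≤ v → q ≡ h * 2 + suc t → edgeLen v ((e + h) * 2 + t) q ≡ 1
edgeLen-turn h t z≤n       2≤v refl = edgeLen-short _ _ 2≤v (inj₁ (+-suc (h * 2) t))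
edgeLen-turn h t (s≤s z≤n) 2≤v refl = edgeLen-short _ _ 2≤v (inj₂ (cong suc (sym (+-suc (h * 2) t))))

pathLengths-ascending : ∀ {v s} p n ys → s + s ≤ v →
  pathLengths v (ascending s p (suc n) ++ ys) ≡ replicate n s ++ pathLengths v (n * s + p ∷ ys)
pathLengths-ascending p zero    ys 2s≤v = refl
pathLengths-ascending {v} {s} p (suc n) ys 2s≤v = cong₂ _∷_ (edgeLen-short p (s + p) 2s≤v (inj₁ refl))
  (trans (pathLengths-ascending (s + p) n ys 2s≤v)
         (cong (λ q → replicate n s ++ pathLengths v (q ∷ ys)) (*-suc-+ n s p)))

pathLengths-descending : ∀ {v s} q n ys → s + s ≤ v →
  pathLengths v (descending s q (suc n) ++ ys) ≡ replicate n s ++ pathLengths v (q ∷ ys)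
pathLengths-descending q zero    ys 2s≤v = refl
pathLengths-descending {s = s} q (suc n) ys 2s≤v =
  cong₂ _∷_ (edgeLen-short (suc n * s + q) (n * s + q) 2s≤v (inj₂ (+-assoc s (n * s) q))) (pathLengths-descending q n ys 2s≤v)

pathLengths-∷ʳ-++ : ∀ v xs p q ys →
  pathLengths v ((xs ∷ʳ p) ++ q ∷ ys) ≡ pathLengths v (xs ∷ʳ p) ++ edgeLen v p q ∷ pathLengths v (q ∷ ys)
pathLengths-∷ʳ-++ v []           p q ys = refl
pathLengths-∷ʳ-++ v (x ∷ [])     p q ys = refl
pathLengths-∷ʳ-++ v (x ∷ y ∷ xs) p q ys = cong (edgeLen v x y ∷_) (pathLengths-∷ʳ-++ v (y ∷ xs) p q ys)

pathLengths-reverse : ∀ v ps → pathLengths v (reverse ps) ≡ reverse (pathLengths v ps)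
pathLengths-reverse v []           = refl
pathLengths-reverse v (p ∷ [])     = refl
pathLengths-reverse v (p ∷ q ∷ ps) = begin
  pathLengths v (reverse (p ∷ q ∷ ps))
    ≡⟨ cong (pathLengths v) (unfold-reverse p (q ∷ ps)) ⟩
  pathLengths v (reverse (q ∷ ps) ∷ʳ p)
    ≡⟨ cong (λ qs → pathLengths v (qs ∷ʳ p)) (unfold-reverse q ps) ⟩
  pathLengths v ((reverse ps ∷ʳ q) ∷ʳ p)
    ≡⟨ pathLengths-∷ʳ-++ v (reverse ps) q p [] ⟩
  pathLengths v (reverse ps ∷ʳ q) ∷ʳ edgeLen v q p
    ≡⟨ cong (λ qs → pathLengths v qs ∷ʳ edgeLen v q p) (unfold-reverse q ps) ⟨
  pathLengths v (reverse (q ∷ ps)) ∷ʳ edgeLen v q p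
    ≡⟨ cong₂ _∷ʳ_ (pathLengths-reverse v (q ∷ ps)) (edgeLen-comm v q p) ⟩
  reverse (pathLengths v (q ∷ ps)) ∷ʳ edgeLen v p q
    ≡⟨ unfold-reverse (edgeLen v p q) (pathLengths v (q ∷ ps)) ⟨
  reverse (pathLengths v (p ∷ q ∷ ps)) ∎
  where open ≡-Reasoning

pathLengths-reverse-++ : ∀ v p ps q qs →
  pathLengths v (reverse (p ∷ ps) ++ q ∷ qs) ≡
  reverse (pathLengths v (p ∷ ps)) ++ edgeLen v p q ∷ pathLengths v (q ∷ qs)
pathLengths-reverse-++ v p ps q qs = begin
  pathLengths v (reverse (p ∷ ps) ++ q ∷ qs)
    ≡⟨ cong (λ rs → pathLengths v (rs ++ q ∷ qs)) (unfold-reverse p ps) ⟩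
  pathLengths v ((reverse ps ∷ʳ p) ++ q ∷ qs)
    ≡⟨ pathLengths-∷ʳ-++ v (reverse ps) p q qs ⟩
  pathLengths v (reverse ps ∷ʳ p) ++ edgeLen v p q ∷ rest
    ≡⟨ cong (λ rs → pathLengths v rs ++ edgeLen v p q ∷ rest) (unfold-reverse p ps) ⟨
  pathLengths v (reverse (p ∷ ps)) ++ edgeLen v p q ∷ rest
    ≡⟨ cong (_++ edgeLen v p q ∷ rest) (pathLengths-reverse v (p ∷ ps)) ⟩
  reverse (pathLengths v (p ∷ ps)) ++ edgeLen v p q ∷ rest ∎
  where
  open ≡-Reasoning
  rest = pathLengths v (q ∷ qs)

length-pathLengths : ∀ v ps → length (pathLengths v ps) ≡ pred (length ps)
length-pathLengths v []           = refl
length-pathLengths v (p ∷ [])     = refl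
length-pathLengths v (p ∷ q ∷ ps) = cong suc (length-pathLengths v (q ∷ ps))

realizable : ∀ {v L} ps → ps ↭ upTo v → pathLengths v ps ↭ L → Realizable v L
realizable ps ps↭ lengths↭ = ps , ↭upTo⇒IsHamPath ps↭ , lengths↭

realizable-length : ∀ {v L} → Realizable v L → length L ≡ pred v
realizable-length {v} (ps , (length≡v , _) , lengths↭) =
  trans (sym (↭-length lengths↭)) (trans (length-pathLengths v ps) (cong pred length≡v))

replicate-+ : ∀ {A : Set} m n (x : A) → replicate (m + n) x ≡ replicate m x ++ replicate n x
replicate-+ zero    n x = refl
replicate-+ (suc m) n x = cong (x ∷_) (replicate-+ m n x)

RealizableWithTwos : ℕ → List ℕ → Set
RealizableWithTwos v js = ∃[ n ] Realizable v (js ++ replicate n 2)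

-- The number of 2's need not be tracked: a Hamiltonian path of K_v has v − 1 edges.
realizable-L12x : ∀ a b x → RealizableWithTwos (a + b + 2) (replicate a 1 ++ [ x ]) →
                  Realizable (a + b + 2) (L12x a b x)
realizable-L12x a b x (n , r@(ps , ham , lengths↭)) = ps , ham , ↭-trans lengths↭ (begin
  (replicate a 1 ++ [ x ]) ++ replicate n 2 ≡⟨ ++-assoc (replicate a 1) [ x ] _ ⟩
  replicate a 1 ++ x ∷ replicate n 2         ↭⟨ ++⁺ˡ (replicate a 1) (∷↭∷ʳ x (replicate n 2)) ⟩
  replicate a 1 ++ replicate n 2 ++ [ x ]    ≡⟨ cong (λ k → replicate a 1 ++ replicate k 2 ++ [ x ]) n≡b ⟩
  L12x a b x                                 ∎)
  where
  open PermutationReasoning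
  n≡b : n ≡ b
  n≡b = +-cancelˡ-≡ (a + 1) n b (trans (sym length≡) (trans (realizable-length r) pred≡))
    where
    length≡ : length ((replicate a 1 ++ [ x ]) ++ replicate n 2) ≡ a + 1 + n
    length≡ = trans (length-++ (replicate a 1 ++ [ x ]))
      (cong₂ _+_ (trans (length-++ (replicate a 1)) (cong (_+ 1) (length-replicate a))) (length-replicate n))
    pred≡ : pred (a + b + 2) ≡ a + 1 + b
    pred≡ = trans (cong pred (+-suc (a + b) 1)) (rearranged a b)
      where
      rearranged : ∀ a b → a + b + 1 ≡ a + 1 + b
      rearranged = solve-∀

-- At most one 1: three runs of step 2

data Run : Set where
  ↗ ↘ : ℕ → ℕ → Run

vertices : Run → List ℕ
vertices (↗ p n) = ascending 2 p (suc n)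
vertices (↘ q n) = descending 2 q (suc n)

first : Run → ℕ
first (↗ p n) = p
first (↘ q n) = n * 2 + q

last : Run → ℕ
last (↗ p n) = n * 2 + p
last (↘ q n) = q

steps : Run → ℕ
steps (↗ _ n) = n
steps (↘ _ n) = n

pathLengths-run : ∀ {v} r ys → 2 + 2 ≤ v →
  pathLengths v (vertices r ++ ys) ≡ replicate (steps r) 2 ++ pathLengths v (last r ∷ ys)
pathLengths-run (↗ p n) ys 4≤v = pathLengths-ascending p n ys 4≤v
pathLengths-run (↘ q n) ys 4≤v = pathLengths-descending q n ys 4≤v

pathLengths-enter : ∀ v p r ys →
  pathLengths v (p ∷ vertices r ++ ys) ≡ edgeLen v p (first r) ∷ pathLengths v (vertices r ++ ys)
pathLengths-enter v p (↗ _ _) ys = refl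
pathLengths-enter v p (↘ _ _) ys = refl

pathLengths-threeRuns : ∀ {v} r₁ r₂ r₃ → 2 + 2 ≤ v →
  pathLengths v (vertices r₁ ++ vertices r₂ ++ vertices r₃) ≡
  replicate (steps r₁) 2 ++ edgeLen v (last r₁) (first r₂) ∷
  replicate (steps r₂) 2 ++ edgeLen v (last r₂) (first r₃) ∷ replicate (steps r₃) 2
pathLengths-threeRuns {v} r₁ r₂ r₃ 4≤v = begin
  pathLengths v (vertices r₁ ++ vertices r₂ ++ vertices r₃)
    ≡⟨ pathLengths-run r₁ _ 4≤v ⟩
  R₁ ++ pathLengths v (last r₁ ∷ vertices r₂ ++ vertices r₃)
    ≡⟨ cong (R₁ ++_) (pathLengths-enter v (last r₁) r₂ _) ⟩
  R₁ ++ J₁ ∷ pathLengths v (vertices r₂ ++ vertices r₃)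
    ≡⟨ cong (λ ls → R₁ ++ J₁ ∷ ls) (pathLengths-run r₂ _ 4≤v) ⟩
  R₁ ++ J₁ ∷ R₂ ++ pathLengths v (last r₂ ∷ vertices r₃)
    ≡⟨ cong (λ ps → R₁ ++ J₁ ∷ R₂ ++ pathLengths v (last r₂ ∷ ps)) (++-identityʳ (vertices r₃)) ⟨
  R₁ ++ J₁ ∷ R₂ ++ pathLengths v (last r₂ ∷ vertices r₃ ++ [])
    ≡⟨ cong (λ ls → R₁ ++ J₁ ∷ R₂ ++ ls) (pathLengths-enter v (last r₂) r₃ []) ⟩
  R₁ ++ J₁ ∷ R₂ ++ J₂ ∷ pathLengths v (vertices r₃ ++ [])
    ≡⟨ cong (λ ls → R₁ ++ J₁ ∷ R₂ ++ J₂ ∷ ls) (trans (pathLengths-run r₃ [] 4≤v) (++-identityʳ R₃)) ⟩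
  R₁ ++ J₁ ∷ R₂ ++ J₂ ∷ R₃ ∎
  where
  open ≡-Reasoning
  R₁ = replicate (steps r₁) 2
  R₂ = replicate (steps r₂) 2
  R₃ = replicate (steps r₃) 2
  J₁ = edgeLen v (last r₁) (first r₂)
  J₂ = edgeLen v (last r₂) (first r₃)

realizable-threeRuns : ∀ {v j₁ j₂} r₁ r₂ r₃ → 2 + 2 ≤ v →
  edgeLen v (last r₁) (first r₂) ≡ j₁ → edgeLen v (last r₂) (first r₃) ≡ j₂ →
  vertices r₁ ++ vertices r₂ ++ vertices r₃ ↭ upTo v →
  Realizable v (j₁ ∷ j₂ ∷ replicate (steps r₁ + (steps r₂ + steps r₃)) 2)
realizable-threeRuns {v} {j₁} {j₂} r₁ r₂ r₃ 4≤v J₁≡j₁ J₂≡j₂ ps↭ =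
  realizable (vertices r₁ ++ vertices r₂ ++ vertices r₃) ps↭ (begin
    pathLengths v (vertices r₁ ++ vertices r₂ ++ vertices r₃) ≡⟨ pathLengths-threeRuns r₁ r₂ r₃ 4≤v ⟩
    R₁ ++ J₁ ∷ R₂ ++ J₂ ∷ R₃                                  ≡⟨ cong₂ (λ j j′ → R₁ ++ j ∷ R₂ ++ j′ ∷ R₃) J₁≡j₁ J₂≡j₂ ⟩
    R₁ ++ j₁ ∷ R₂ ++ j₂ ∷ R₃                                  ↭⟨ shift j₁ R₁ _ ⟩
    j₁ ∷ R₁ ++ R₂ ++ j₂ ∷ R₃                                  ↭⟨ ↭-prep j₁ (++⁺ˡ R₁ (shift j₂ R₂ R₃)) ⟩
    j₁ ∷ R₁ ++ j₂ ∷ R₂ ++ R₃                                  ↭⟨ ↭-prep j₁ (shift j₂ R₁ _) ⟩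
    j₁ ∷ j₂ ∷ R₁ ++ R₂ ++ R₃                                  ≡⟨ cong (λ ls → j₁ ∷ j₂ ∷ ls) replicates ⟨
    j₁ ∷ j₂ ∷ replicate (steps r₁ + (steps r₂ + steps r₃)) 2  ∎)
  where
  open PermutationReasoning
  R₁ = replicate (steps r₁) 2
  R₂ = replicate (steps r₂) 2
  R₃ = replicate (steps r₃) 2
  J₁ = edgeLen v (last r₁) (first r₂)
  J₂ = edgeLen v (last r₂) (first r₃)
  replicates : replicate (steps r₁ + (steps r₂ + steps r₃)) 2 ≡ R₁ ++ R₂ ++ R₃
  replicates = trans (replicate-+ (steps r₁) _ 2) (cong (R₁ ++_) (replicate-+ (steps r₂) (steps r₃) 2))

evens++odds↭upTo : ∀ {e v evens odds} n → e ≤ 1 → e + (n + n) ≡ v →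
  evens ↭ ascending 2 0 (e + n) → odds ↭ ascending 2 1 n → evens ++ odds ↭ upTo v
evens++odds↭upTo n e≤1 refl evens↭ odds↭ =
  ↭-trans (++⁺ evens↭ odds↭) (↭-trans (interleave 0 n e≤1) (↭-reflexive (ascending-upTo _)))

++-swap₂₃ : ∀ {A : Set} (xs ys zs : List A) → xs ++ ys ++ zs ↭ (xs ++ zs) ++ ys
++-swap₂₃ xs ys zs = ↭-trans (++⁺ˡ xs (++-comm ys zs)) (↭-reflexive (sym (++-assoc xs zs ys)))

4≤double : ∀ k r → 2 + 2 ≤ (2 + k) + (2 + k) + r
4≤double k r = ≤-trans (+-mono-≤ (s≤s (s≤s z≤n)) (s≤s (s≤s z≤n))) (m≤m+n _ r)

realizable₁-oddJump : ∀ {x} j i e → x ≡ 3 + j * 2 → e ≤ 1 → RealizableWithTwos (x + x + (e + i * 2)) (1 ∷ [ x ])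
realizable₁-oddJump {x} j i e refl e≤1 =
  _ , realizable-threeRuns (↘ 0 (j + i)) (↗ 1 M) (↗ (suc (j + i) * 2) (e + suc j)) 4≤v
        (edgeLen-short 0 1 (≤-trans (s≤s (s≤s z≤n)) 4≤v) (inj₁ refl))
        (edgeLen-short (M * 2 + 1) (suc (j + i) * 2) (m≤m+n (x + x) _) (inj₂ (top≡ j i)))
        (↭-trans (++-swap₂₃ (descending 2 0 (suc (j + i))) _ _)
                 (evens++odds↭upTo (suc M) e≤1 (order≡ e j i) evens↭ ↭-refl))
  where
  M = 2 + j * 2 + i
  4≤v : 2 + 2 ≤ x + x + (e + i * 2)
  4≤v = 4≤double (suc (j * 2)) (e + i * 2)
  top≡ : ∀ j i → (2 + j * 2 + i) * 2 + 1 ≡ 3 + j * 2 + suc (j + i) * 2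
  top≡ = solve-∀
  order≡ : ∀ e j i → e + (suc (2 + j * 2 + i) + suc (2 + j * 2 + i)) ≡ 3 + j * 2 + (3 + j * 2) + (e + i * 2)
  order≡ = solve-∀
  evens↭ : descending 2 0 (suc (j + i)) ++ ascending 2 (suc (j + i) * 2) (suc (e + suc j)) ↭ ascending 2 0 (e + suc M)
  evens↭ = ↭-trans (++⁺ʳ _ (descending↭ascending 2 0 (suc (j + i))))
                   (↭-reflexive (ascending-join (suc (j + i)) (suc (e + suc j)) (sym (+-identityʳ _)) (joined e j i)))
    where
    joined : ∀ e j i → suc (j + i) + suc (e + suc j) ≡ e + suc (2 + j * 2 + i)
    joined = solve-∀

realizable₁-evenJump : ∀ {x} j i e → x ≡ 2 + j * 2 → e ≤ 1 → RealizableWithTwos (x + x + (e + i * 2)) (1 ∷ [ x ])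
realizable₁-evenJump {x} j i e refl e≤1 =
  _ , realizable-threeRuns (↗ 0 (e + h)) (↘ (3 + j * 2) (j + i)) (↗ 1 j) 4≤v
        (edgeLen-turn h 0 e≤1 (≤-trans (s≤s (s≤s z≤n)) 4≤v) (turn≡ j i))
        (edgeLen-short (3 + j * 2) 1 (m≤m+n (x + x) _) (inj₂ (sym (+-comm x 1))))
        (evens++odds↭upTo (suc h) e≤1 (order≡ e j i)
          (↭-reflexive (cong (ascending 2 0) (sym (+-suc e h)))) odds↭)
  where
  h = 1 + j * 2 + i
  4≤v : 2 + 2 ≤ x + x + (e + i * 2)
  4≤v = 4≤double (j * 2) (e + i * 2)
  turn≡ : ∀ j i → (j + i) * 2 + (3 + j * 2) ≡ (1 + j * 2 + i) * 2 + 1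
  turn≡ = solve-∀
  order≡ : ∀ e j i → e + (suc (1 + j * 2 + i) + suc (1 + j * 2 + i)) ≡ 2 + j * 2 + (2 + j * 2) + (e + i * 2)
  order≡ = solve-∀
  odds↭ : descending 2 (3 + j * 2) (suc (j + i)) ++ ascending 2 1 (suc j) ↭ ascending 2 1 (suc h)
  odds↭ = ↭-trans (++-comm (descending 2 (3 + j * 2) (suc (j + i))) _)
          (↭-trans (++⁺ˡ (ascending 2 1 (suc j)) (descending↭ascending 2 (3 + j * 2) (suc (j + i))))
          (↭-reflexive (ascending-join (suc j) (suc (j + i)) (start≡ j) (joined j i))))
    where
    start≡ : ∀ j → 3 + j * 2 ≡ suc j * 2 + 1
    start≡ = solve-∀
    joined : ∀ j i → suc j + suc (j + i) ≡ suc (1 + j * 2 + i)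
    joined = solve-∀

realizable₀-oddJump-evenOrder : ∀ {x} j i → x ≡ 3 + j * 2 → RealizableWithTwos (x + x + i * 2) [ x ]
realizable₀-oddJump-evenOrder {x} j i refl =
  suc _ , realizable-threeRuns (↘ 0 (2 + j * 2 + i)) (↗ x (suc (j + i))) (↗ 1 j) (4≤double (suc (j * 2)) (i * 2))
            (edgeLen-short 0 x (m≤m+n (x + x) _) (inj₁ (sym (+-identityʳ x))))
            (edgeLen-wrap (suc (j + i) * 2 + x) 1 (4 + (j * 4 + i * 2)) (wrap≡ j i) (s≤s (s≤s z≤n)) (inj₂ (top≡ j i)))
            (evens++odds↭upTo (3 + j * 2 + i) z≤n (order≡ j i) (descending↭ascending 2 0 _) odds↭)
  where
  wrap≡ : ∀ j i → 4 + (j * 4 + i * 2) + 2 ≡ 3 + j * 2 + (3 + j * 2) + i * 2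
  wrap≡ = solve-∀
  top≡ : ∀ j i → suc (j + i) * 2 + (3 + j * 2) ≡ 4 + (j * 4 + i * 2) + 1
  top≡ = solve-∀
  order≡ : ∀ j i → (3 + j * 2 + i) + (3 + j * 2 + i) ≡ 3 + j * 2 + (3 + j * 2) + i * 2
  order≡ = solve-∀
  odds↭ : ascending 2 x (suc (suc (j + i))) ++ ascending 2 1 (suc j) ↭ ascending 2 1 (3 + j * 2 + i)
  odds↭ = ↭-trans (++-comm (ascending 2 x (suc (suc (j + i)))) _)
                  (↭-reflexive (ascending-join (suc j) (suc (suc (j + i))) (start≡ j) (joined j i)))
    where
    start≡ : ∀ j → 3 + j * 2 ≡ suc j * 2 + 1
    start≡ = solve-∀
    joined : ∀ j i → suc j + suc (suc (j + i)) ≡ 3 + j * 2 + i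
    joined = solve-∀

realizable₀-oddJump-oddOrder : ∀ {x} j i → x ≡ 3 + j * 2 → RealizableWithTwos (x + x + suc (i * 2)) [ x ]
realizable₀-oddJump-oddOrder {x} j i refl =
  suc _ , realizable-threeRuns (↗ 0 m) (↘ 1 (2 + j * 2 + i)) (↘ (suc m * 2) (suc j)) (4≤double (suc (j * 2)) _)
            (edgeLen-short (m * 2 + 0) ((2 + j * 2 + i) * 2 + 1) (m≤m+n (x + x) _) (inj₁ (jump≡ j i)))
            (edgeLen-wrap 1 (suc j * 2 + suc m * 2) (5 + (j * 4 + i * 2)) (wrap≡ j i) (s≤s (s≤s z≤n)) (inj₁ (top≡ j i)))
            (↭-trans (++-swap₂₃ (ascending 2 0 (suc m)) _ _)
                     (evens++odds↭upTo (3 + j * 2 + i) (s≤s z≤n) (order≡ j i) evens↭ (descending↭ascending 2 1 _)))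
  where
  m = suc (j + i)
  jump≡ : ∀ j i → (2 + j * 2 + i) * 2 + 1 ≡ 3 + j * 2 + (suc (j + i) * 2 + 0)
  jump≡ = solve-∀
  wrap≡ : ∀ j i → 5 + (j * 4 + i * 2) + 2 ≡ 3 + j * 2 + (3 + j * 2) + suc (i * 2)
  wrap≡ = solve-∀
  top≡ : ∀ j i → suc j * 2 + suc (suc (j + i)) * 2 ≡ 5 + (j * 4 + i * 2) + 1
  top≡ = solve-∀
  order≡ : ∀ j i → 1 + ((3 + j * 2 + i) + (3 + j * 2 + i)) ≡ 3 + j * 2 + (3 + j * 2) + suc (i * 2)
  order≡ = solve-∀
  evens↭ : ascending 2 0 (suc m) ++ descending 2 (suc m * 2) (suc (suc j)) ↭ ascending 2 0 (1 + (3 + j * 2 + i))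
  evens↭ = ↭-trans (++⁺ˡ (ascending 2 0 (suc m)) (descending↭ascending 2 (suc m * 2) (suc (suc j))))
                   (↭-reflexive (ascending-join (suc m) (suc (suc j)) (sym (+-identityʳ _)) (joined j i)))
    where
    joined : ∀ j i → suc (suc (j + i)) + suc (suc j) ≡ 1 + (3 + j * 2 + i)
    joined = solve-∀

realizable₀-evenJump-oddOrder : ∀ {x} j i → x ≡ 2 + j * 2 → RealizableWithTwos (x + x + suc (i * 2)) [ x ]
realizable₀-evenJump-oddOrder {x} j i refl =
  suc _ , realizable-threeRuns (↗ (3 + m * 2) j) (↘ 1 m) (↘ 0 M) (4≤double (j * 2) _)
            (edgeLen-short (j * 2 + (3 + m * 2)) (m * 2 + 1) (m≤m+n (x + x) _) (inj₂ (jump≡ j i)))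
            (edgeLen-wrap 1 (M * 2 + 0) (3 + (j * 4 + i * 2)) (wrap≡ j i) (s≤s (s≤s z≤n)) (inj₁ (top≡ j i)))
            (↭-trans (↭-reflexive (sym (++-assoc (ascending 2 (3 + m * 2) (suc j)) _ _)))
            (↭-trans (++-comm (ascending 2 (3 + m * 2) (suc j) ++ descending 2 1 (suc m)) _)
                     (evens++odds↭upTo M (s≤s z≤n) (order≡ j i) (descending↭ascending 2 0 (suc M)) odds↭)))
  where
  m = j + i
  M = 2 + j * 2 + i
  jump≡ : ∀ j i → j * 2 + (3 + (j + i) * 2) ≡ 2 + j * 2 + ((j + i) * 2 + 1)
  jump≡ = solve-∀
  wrap≡ : ∀ j i → 3 + (j * 4 + i * 2) + 2 ≡ 2 + j * 2 + (2 + j * 2) + suc (i * 2)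
  wrap≡ = solve-∀
  top≡ : ∀ j i → (2 + j * 2 + i) * 2 + 0 ≡ 3 + (j * 4 + i * 2) + 1
  top≡ = solve-∀
  order≡ : ∀ j i → 1 + ((2 + j * 2 + i) + (2 + j * 2 + i)) ≡ 2 + j * 2 + (2 + j * 2) + suc (i * 2)
  order≡ = solve-∀
  odds↭ : ascending 2 (3 + m * 2) (suc j) ++ descending 2 1 (suc m) ↭ ascending 2 1 M
  odds↭ = ↭-trans (++-comm (ascending 2 (3 + m * 2) (suc j)) _)
          (↭-trans (++⁺ʳ (ascending 2 (3 + m * 2) (suc j)) (descending↭ascending 2 1 (suc m)))
          (↭-reflexive (ascending-join (suc m) (suc j) (start≡ j i) (joined j i))))
    where
    start≡ : ∀ j i → 3 + (j + i) * 2 ≡ suc (j + i) * 2 + 1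
    start≡ = solve-∀
    joined : ∀ j i → suc (j + i) + suc j ≡ 2 + j * 2 + i
    joined = solve-∀

-- Blocks: x = 1, or at least two 1's

-- e is the parity of the number of 2's; it decides whether the turn from the upward
-- 2's into the downward ones goes up or down by one (edgeLen-turn).
block : ℕ → ℕ → ℕ → ℕ → List ℕ
block p c h e = ascending 1 p (suc c) ++ ascending 2 (2 + (c + p)) (e + h) ++ descending 2 (suc (c + p)) (suc h)

blockSize : ℕ → ℕ → ℕ → ℕ
blockSize c h e = 2 + c + (e + h * 2)

block↭ascending : ∀ p c h {e} → e ≤ 1 → block p c h e ↭ ascending 1 p (blockSize c h e)
block↭ascending p c h {e} e≤1 = begin
  ascending 1 p (suc c) ++ U ++ descending 2 (suc t) (suc h)
    ↭⟨ ++⁺ˡ (ascending 1 p (suc c)) (↭-trans (++⁺ˡ U (descending↭ascending 2 (suc t) (suc h))) (++-comm U _)) ⟩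
  ascending 1 p (suc c) ++ ascending 2 (suc t) (suc h) ++ U
    ↭⟨ ++⁺ˡ (ascending 1 p (suc c)) (zigzag e≤1) ⟩
  ascending 1 p (suc c) ++ ascending 1 (suc t) (suc (e + h * 2))
    ≡⟨ ascending-join (suc c) (suc (e + h * 2)) (cong (λ k → suc (k + p)) (sym (*-identityʳ c))) (+-suc (suc c) _) ⟩
  ascending 1 p (blockSize c h e) ∎
  where
  open PermutationReasoning
  t = c + p
  U = ascending 2 (2 + t) (e + h)
  zigzag : e ≤ 1 → ascending 2 (suc t) (suc h) ++ U ↭ ascending 1 (suc t) (suc (e + h * 2))
  zigzag z≤n       = ↭-trans (interleave (suc t) h (s≤s z≤n)) (↭-reflexive (cong (λ k → ascending 1 (suc t) (suc k)) (double h)))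
    where
    double : ∀ h → h + h ≡ h * 2
    double = solve-∀
  zigzag (s≤s z≤n) = ↭-trans (interleave (suc t) (suc h) z≤n) (↭-reflexive (cong (ascending 1 (suc t)) (double h)))
    where
    double : ∀ h → suc h + suc h ≡ suc (1 + h * 2)
    double = solve-∀

pathLengths-block : ∀ {v} p c h {e} → e ≤ 1 → 2 + 2 ≤ v →
  pathLengths v (block p c h e) ≡ replicate c 1 ++ replicate (e + h) 2 ++ 1 ∷ replicate h 2
pathLengths-block {v} p c h {e} e≤1 4≤v = begin
  pathLengths v (block p c h e)
    ≡⟨ pathLengths-ascending p c _ 2≤v ⟩
  replicate c 1 ++ pathLengths v (c * 1 + p ∷ U ++ D)
    ≡⟨ cong (λ q → replicate c 1 ++ pathLengths v (q ∷ U ++ D)) (cong (_+ p) (*-identityʳ c)) ⟩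
  replicate c 1 ++ pathLengths v (ascending 2 t (suc (e + h)) ++ D)
    ≡⟨ cong (replicate c 1 ++_) (pathLengths-ascending t (e + h) D 4≤v) ⟩
  replicate c 1 ++ replicate (e + h) 2 ++ edgeLen v ((e + h) * 2 + t) (h * 2 + suc t) ∷ pathLengths v D
    ≡⟨ cong (λ l → replicate c 1 ++ replicate (e + h) 2 ++ l ∷ pathLengths v D) (edgeLen-turn h t e≤1 2≤v refl) ⟩
  replicate c 1 ++ replicate (e + h) 2 ++ 1 ∷ pathLengths v D
    ≡⟨ cong (λ ls → replicate c 1 ++ replicate (e + h) 2 ++ 1 ∷ ls) descent ⟩
  replicate c 1 ++ replicate (e + h) 2 ++ 1 ∷ replicate h 2 ∎
  where
  open ≡-Reasoning
  t = c + p
  U = ascending 2 (2 + t) (e + h)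
  D = descending 2 (suc t) (suc h)
  2≤v : 1 + 1 ≤ v
  2≤v = ≤-trans (s≤s (s≤s z≤n)) 4≤v
  descent : pathLengths v D ≡ replicate h 2
  descent = trans (cong (pathLengths v) (sym (++-identityʳ D)))
                  (trans (pathLengths-descending (suc t) h [] 4≤v) (++-identityʳ (replicate h 2)))

onesTwos : ℕ → ℕ → List ℕ
onesTwos a b = replicate a 1 ++ replicate b 2

onesTwos-++ : ∀ a b c d → onesTwos a b ++ onesTwos c d ↭ onesTwos (a + c) (b + d)
onesTwos-++ a b c d = begin
  (A ++ B) ++ C ++ D  ≡⟨ ++-assoc A B (C ++ D) ⟩
  A ++ B ++ C ++ D    ↭⟨ ++⁺ˡ A (shifts B C) ⟩
  A ++ C ++ B ++ D    ≡⟨ ++-assoc A C (B ++ D) ⟨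
  (A ++ C) ++ B ++ D  ≡⟨ cong₂ _++_ (replicate-+ a c 1) (replicate-+ b d 2) ⟨
  onesTwos (a + c) (b + d) ∎
  where
  open PermutationReasoning
  A = replicate a 1
  B = replicate b 2
  C = replicate c 1
  D = replicate d 2

onesTwos↭withTwos : ∀ a n y → y ∷ onesTwos a n ↭ (replicate a 1 ++ [ y ]) ++ replicate n 2
onesTwos↭withTwos a n y = ↭-trans (↭-sym (shift y (replicate a 1) _)) (↭-reflexive (sym (++-assoc (replicate a 1) [ y ] _)))

blockLengths↭onesTwos : ∀ c h e → replicate c 1 ++ replicate (e + h) 2 ++ 1 ∷ replicate h 2 ↭ onesTwos (suc c) (e + h + h)
blockLengths↭onesTwos c h e = begin
  replicate c 1 ++ replicate (e + h) 2 ++ 1 ∷ replicate h 2   ↭⟨ ++⁺ˡ (replicate c 1) (shift 1 (replicate (e + h) 2) _) ⟩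
  replicate c 1 ++ 1 ∷ replicate (e + h) 2 ++ replicate h 2   ↭⟨ shift 1 (replicate c 1) _ ⟩
  1 ∷ replicate c 1 ++ replicate (e + h) 2 ++ replicate h 2   ≡⟨ cong (λ ts → 1 ∷ replicate c 1 ++ ts) (replicate-+ (e + h) h 2) ⟨
  onesTwos (suc c) (e + h + h)                                ∎
  where open PermutationReasoning

realizable-straightPath : ∀ a → RealizableWithTwos (2 + a) (replicate a 1 ++ [ 1 ])
realizable-straightPath a = 0 , realizable (ascending 1 0 (2 + a)) (↭-reflexive (ascending-upTo (2 + a))) (begin
  pathLengths (2 + a) (ascending 1 0 (2 + a))        ≡⟨ cong (pathLengths (2 + a)) (++-identityʳ (ascending 1 0 (2 + a))) ⟨
  pathLengths (2 + a) (ascending 1 0 (2 + a) ++ [])  ≡⟨ pathLengths-ascending {s = 1} 0 (suc a) [] (s≤s (s≤s z≤n)) ⟩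
  replicate (suc a) 1 ++ []                          ↭⟨ ++⁺ʳ [] (∷↭∷ʳ 1 (replicate a 1)) ⟩
  (replicate a 1 ++ [ 1 ]) ++ []                     ∎)
  where open PermutationReasoning

realizable-block : ∀ c h {e} → e ≤ 1 → 2 + 2 ≤ c + (e + h * 2) + 2 →
                   RealizableWithTwos (c + (e + h * 2) + 2) (replicate c 1 ++ [ 1 ])
realizable-block c h {e} e≤1 4≤v =
  e + h + h , realizable (block 0 c h e) vertices↭
    (↭-trans (↭-reflexive (pathLengths-block 0 c h e≤1 4≤v))
             (↭-trans (blockLengths↭onesTwos c h e) (onesTwos↭withTwos c (e + h + h) 1)))
  where
  vertices↭ : block 0 c h e ↭ upTo (c + (e + h * 2) + 2)
  vertices↭ = ↭-trans (block↭ascending 0 c h e≤1)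
                      (↭-reflexive (trans (ascending-upTo _) (cong upTo (+-comm 2 (c + (e + h * 2))))))

realizable-twoBlocks : ∀ c₁ h₁ {e₁} c₂ h₂ {e₂} → e₁ ≤ 1 → e₂ ≤ 1 →
  blockSize c₁ h₁ e₁ ≤ blockSize c₂ h₂ e₂ →
  RealizableWithTwos (blockSize c₁ h₁ e₁ + blockSize c₂ h₂ e₂)
                     (replicate (suc c₁ + suc c₂) 1 ++ [ blockSize c₁ h₁ e₁ ])
realizable-twoBlocks c₁ h₁ {e₁} c₂ h₂ {e₂} e₁≤1 e₂≤1 X≤Y =
  n₁ + n₂ , realizable (reverse B₁ ++ B₂) vertices↭ (begin
    pathLengths v (reverse B₁ ++ B₂)
      ≡⟨ pathLengths-reverse-++ v 0 (drop 1 B₁) X (drop 1 B₂) ⟩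
    reverse (pathLengths v B₁) ++ edgeLen v 0 X ∷ pathLengths v B₂
      ≡⟨ cong₂ (λ j ls → reverse (pathLengths v B₁) ++ j ∷ ls) (edgeLen-short 0 X (+-monoʳ-≤ X X≤Y) (inj₁ (sym (+-identityʳ X))))
               (pathLengths-block X c₂ h₂ e₂≤1 4≤v) ⟩
    reverse (pathLengths v B₁) ++ X ∷ L₂
      ≡⟨ cong (λ ls → reverse ls ++ X ∷ L₂) (pathLengths-block 0 c₁ h₁ e₁≤1 4≤v) ⟩
    reverse L₁ ++ X ∷ L₂                                ↭⟨ shift X (reverse L₁) L₂ ⟩
    X ∷ reverse L₁ ++ L₂                                ↭⟨ ↭-prep X (++⁺ (↭-reverse L₁) ↭-refl) ⟩
    X ∷ L₁ ++ L₂                                        ↭⟨ ↭-prep X (++⁺ (blockLengths↭onesTwos c₁ h₁ e₁) (blockLengths↭onesTwos c₂ h₂ e₂)) ⟩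
    X ∷ onesTwos (suc c₁) n₁ ++ onesTwos (suc c₂) n₂    ↭⟨ ↭-prep X (onesTwos-++ (suc c₁) n₁ (suc c₂) n₂) ⟩
    X ∷ onesTwos (suc c₁ + suc c₂) (n₁ + n₂)            ↭⟨ onesTwos↭withTwos (suc c₁ + suc c₂) (n₁ + n₂) X ⟩
    (replicate (suc c₁ + suc c₂) 1 ++ [ X ]) ++ replicate (n₁ + n₂) 2 ∎)
  where
  open PermutationReasoning
  X = blockSize c₁ h₁ e₁
  v = X + blockSize c₂ h₂ e₂
  B₁ = block 0 c₁ h₁ e₁
  B₂ = block X c₂ h₂ e₂
  L₁ = replicate c₁ 1 ++ replicate (e₁ + h₁) 2 ++ 1 ∷ replicate h₁ 2
  L₂ = replicate c₂ 1 ++ replicate (e₂ + h₂) 2 ++ 1 ∷ replicate h₂ 2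
  n₁ = e₁ + h₁ + h₁
  n₂ = e₂ + h₂ + h₂
  4≤v : 2 + 2 ≤ v
  4≤v = ≤-trans (4≤double (c₁ + (e₁ + h₁ * 2)) 0) (≤-trans (≤-reflexive (+-identityʳ (X + X))) (+-monoʳ-≤ X X≤Y))
  vertices↭ : reverse B₁ ++ B₂ ↭ upTo v
  vertices↭ = ↭-trans (++⁺ (↭-trans (↭-reverse B₁) (block↭ascending 0 c₁ h₁ e₁≤1)) (block↭ascending X c₂ h₂ e₂≤1))
              (↭-trans (↭-reflexive (ascending-join X _ (trans (sym (*-identityʳ X)) (sym (+-identityʳ (X * 1)))) refl))
                       (↭-reflexive (ascending-upTo v)))

-- Admissibility and the case analysis

half⇒double≤ : ∀ {y v} → y ≤ v / 2 → y + y ≤ v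
half⇒double≤ {y} {v} y≤v/2 = ≤-trans (≤-reflexive (double y)) (≤-trans (*-monoˡ-≤ 2 y≤v/2) (m/n*n≤m v 2))
  where
  double : ∀ y → y + y ≡ y * 2
  double = solve-∀

admissible⇒double≤ : ∀ {v L y} → Admissible v L → y ∈ L → y + y ≤ v
admissible⇒double≤ (_ , bounds , _) y∈L = half⇒double≤ (proj₂ (All.lookup bounds y∈L))

admissible⇒jump≤ : ∀ a b x → Admissible (a + b + 2) (L12x a b x) → x + x ≤ a + b + 2
admissible⇒jump≤ a b x adm = admissible⇒double≤ adm (∈-++⁺ʳ (replicate a 1) (∈-++⁺ʳ (replicate b 2) (here refl)))

admissible⇒4≤ : ∀ a b x → Admissible (a + b + 2) (L12x a b x) → 1 ≤ b → 2 + 2 ≤ a + b + 2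
admissible⇒4≤ a (suc b) x adm _ = admissible⇒double≤ adm (∈-++⁺ʳ (replicate a 1) (here refl))

countMultiples-replicate : ∀ d n {y} → d ∣ y → countMultiples d (replicate n d ++ [ y ]) ≡ suc n
countMultiples-replicate d zero    d∣y = cong length (filter-accept (d ∣?_) {xs = []} d∣y)
countMultiples-replicate d (suc n) d∣y =
  trans (cong length (filter-accept (d ∣?_) ∣-refl)) (cong suc (countMultiples-replicate d n d∣y))

admissible⇒¬bothEven : ∀ b x → Admissible (0 + b + 2) (L12x 0 b x) → 2 ∣ 0 + b + 2 → 2 ∣ x → ⊥
admissible⇒¬bothEven b x (_ , _ , multiples≤) 2∣v 2∣x = n≮n b (begin
  suc b                   ≡⟨ countMultiples-replicate 2 b 2∣x ⟨
  countMultiples 2 (L12x 0 b x) ≤⟨ multiples≤ 2 2∣v ⟩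
  b + 2 ∸ 2               ≡⟨ m+n∸n≡m b 2 ⟩
  b                       ∎)
  where open ≤-Reasoning

halve : ∀ n → ∃[ h ] ∃[ e ] e ≤ 1 × e + h * 2 ≡ n
halve zero = 0 , 0 , z≤n , refl
halve (suc n) with halve n
... | h , _ , z≤n     , refl = h , 1 , s≤s z≤n , refl
... | h , _ , s≤s z≤n , refl = suc h , 0 , z≤n , refl

withTwos-unitJump : ∀ a b → (1 ≤ b → 2 + 2 ≤ a + b + 2) → RealizableWithTwos (a + b + 2) (replicate a 1 ++ [ 1 ])
withTwos-unitJump a b 4≤v with halve b
... | zero  , _ , z≤n     , refl = subst₂ RealizableWithTwos (size≡ a) refl (realizable-straightPath a)
  where
  size≡ : ∀ a → 2 + a ≡ a + 0 + 2
  size≡ = solve-∀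
... | zero  , _ , s≤s z≤n , refl = realizable-block a 0 (s≤s z≤n) (4≤v (s≤s z≤n))
... | suc h , e , e≤1     , refl = realizable-block a (suc h) e≤1 (4≤v (≤-trans (s≤s z≤n) (m≤n+m _ e)))

withTwos-singleOne : ∀ b x′ → 2 + x′ + (2 + x′) ≤ 1 + b + 2 → RealizableWithTwos (1 + b + 2) (1 ∷ [ 2 + x′ ])
withTwos-singleOne b x′ 2x≤v with m≤n⇒∃[o]m+o≡n 2x≤v
... | w , v≡ with halve x′ | halve w
...   | j , _ , z≤n     , refl | i , e , e≤1 , refl =
  subst₂ RealizableWithTwos v≡ refl (realizable₁-evenJump j i e refl e≤1)
...   | j , _ , s≤s z≤n , refl | i , e , e≤1 , refl =
  subst₂ RealizableWithTwos v≡ refl (realizable₁-oddJump j i e refl e≤1)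

withTwos-noOnes : ∀ b x′ → 2 + x′ + (2 + x′) ≤ 0 + b + 2 → (2 ∣ 0 + b + 2 → 2 ∣ 2 + x′ → ⊥) →
                  RealizableWithTwos (0 + b + 2) [ 2 + x′ ]
withTwos-noOnes b x′ 2x≤v ¬bothEven with m≤n⇒∃[o]m+o≡n 2x≤v
... | w , v≡ with halve x′ | halve w
...   | j , _ , z≤n     , refl | i , _ , z≤n     , refl =
  ⊥-elim (¬bothEven (subst (2 ∣_) v≡ (divides (suc j + suc j + i) (evenOrder j i))) (divides (suc j) refl))
  where
  evenOrder : ∀ j i → 2 + j * 2 + (2 + j * 2) + i * 2 ≡ (suc j + suc j + i) * 2
  evenOrder = solve-∀
...   | j , _ , z≤n     , refl | i , _ , s≤s z≤n , refl =
  subst₂ RealizableWithTwos v≡ refl (realizable₀-evenJump-oddOrder j i refl)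
...   | j , _ , s≤s z≤n , refl | i , _ , z≤n     , refl =
  subst₂ RealizableWithTwos v≡ refl (realizable₀-oddJump-evenOrder j i refl)
...   | j , _ , s≤s z≤n , refl | i , _ , s≤s z≤n , refl =
  subst₂ RealizableWithTwos v≡ refl (realizable₀-oddJump-oddOrder j i refl)

-- The first block, of size x, takes min(a′, x′) + 1 of the 1's.
withTwos-manyOnes : ∀ a′ b x′ → 2 + x′ + (2 + x′) ≤ 2 + a′ + b + 2 →
                    RealizableWithTwos (2 + a′ + b + 2) (replicate (2 + a′) 1 ++ [ 2 + x′ ])
withTwos-manyOnes a′ b x′ 2x≤v with ≤-total a′ x′
... | inj₁ a′≤x′ with m≤n⇒∃[o]m+o≡n a′≤x′ | m≤n⇒∃[o]m+o≡n 2x≤v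
...   | t , refl | w , v≡ with halve t | halve (a′ + t + w)
...     | h₁ , e₁ , e₁≤1 , refl | h₂ , e₂ , e₂≤1 , twos≡ =
  subst₂ RealizableWithTwos (trans size≡ v≡) (cong (λ a → replicate a 1 ++ [ 2 + x′ ]) (cong suc (+-comm a′ 1)))
         (realizable-twoBlocks a′ h₁ 0 h₂ e₁≤1 e₂≤1 (subst (2 + x′ ≤_) (cong (2 +_) (sym twos≡)) (s≤s (s≤s (m≤m+n x′ w)))))
  where
  size≡ : 2 + x′ + (2 + (e₂ + h₂ * 2)) ≡ 2 + x′ + (2 + x′) + w
  size≡ = trans (cong (λ k → 2 + x′ + (2 + k)) twos≡) (sym (+-assoc (2 + x′) (2 + x′) w))
withTwos-manyOnes a′ b x′ 2x≤v | inj₂ x′≤a′ with m≤n⇒∃[o]m+o≡n x′≤a′ | halve b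
...   | d , refl | h₂ , e₂ , e₂≤1 , refl =
  subst₂ RealizableWithTwos (size≡ x′ d (e₂ + h₂ * 2))
         (cong₂ (λ a x → replicate a 1 ++ [ x ]) (cong suc (+-suc x′ d)) (+-identityʳ (2 + x′)))
         (realizable-twoBlocks x′ 0 {0} d h₂ z≤n e₂≤1 (subst (_≤ Y) (sym (+-identityʳ (2 + x′))) X≤Y))
  where
  Y = 2 + d + (e₂ + h₂ * 2)
  size≡ : ∀ x′ d b → 2 + x′ + 0 + (2 + d + b) ≡ 2 + (x′ + d) + b + 2
  size≡ = solve-∀
  order≡ : ∀ x′ d b → 2 + (x′ + d) + b + 2 ≡ 2 + x′ + (2 + d + b)
  order≡ = solve-∀
  X≤Y : 2 + x′ ≤ Y
  X≤Y = +-cancelˡ-≤ (2 + x′) (2 + x′) Y (subst (2 + x′ + (2 + x′) ≤_) (order≡ x′ d (e₂ + h₂ * 2)) 2x≤v)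

lemma5p1 : (a b x : ℕ) → 1 ≤ x →
    Admissible (a + b + 2) (L12x a b x) →
    Realizable (a + b + 2) (L12x a b x)
lemma5p1 a b (suc zero) _ adm =
  realizable-L12x a b 1 (withTwos-unitJump a b (admissible⇒4≤ a b 1 adm))
lemma5p1 zero b (suc (suc x′)) _ adm =
  realizable-L12x 0 b _ (withTwos-noOnes b x′ (admissible⇒jump≤ 0 b _ adm) (admissible⇒¬bothEven b _ adm))
lemma5p1 (suc zero) b (suc (suc x′)) _ adm =
  realizable-L12x 1 b _ (withTwos-singleOne b x′ (admissible⇒jump≤ 1 b _ adm))
lemma5p1 (suc (suc a′)) b (suc (suc x′)) _ adm =
  realizable-L12x (2 + a′) b _ (withTwos-manyOnes a′ b x′ (admissible⇒jump≤ (2 + a′) b _ adm))
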